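{- Run Algorithm 1 (described in the context) on a symmetric nonnegative integer matrix $\mathcal{J}$ for which every $\mathcal{D}_k=\frac1k(\mathcal{J}_{k,k}+\sum_l\mathcal{J}_{k,l})$ is an integer. After every iteration, for every degree $k$ and every pair of vertices $u,v$ of target degree $k$, the residual degrees satisfy $|\hat d_u-\hat d_v|\le 1$.
   Context: Given $\mathcal{J}$, fix a vertex set consisting of $\mathcal{D}_k$ vertices of target degree $k$ for each $k$; the residual degree $\hat d_v$ of a vertex $v$ is its target degree minus the number of edges currently incident to it. Algorithm 1 starts from the empty graph $G$ on this vertex set and processes the pairs $(k,l)$ with $k\ge l$ in order of decreasing $k$ and, for fixed $k$, decreasing $l$. For a pair with $k\neq l$: let $a=\mathcal{J}_{k,l}\bmod \mathcal{D}_k$ and $b=\mathcal{J}_{k,l}\bmod\mathcal{D}_l$; construct a simple bipartite graph $B$ with one side of $\mathcal{D}_k$ vertices having degrees $x_1=\dots=x_a=\lfloor \mathcal{J}_{k,l}/\mathcal{D}_k\rfloor+1$, $x_{a+1}=\dots=x_{\mathcal{D}_k}=\lfloor \mathcal{J}_{k,l}/\mathcal{D}_k\rfloor$, and the other side of $\mathcal{D}_l$ vertices having degrees $y_1=\dots=y_b=\lfloor \mathcal{J}_{k,l}/\mathcal{D}_l\rfloor+1$, $y_{b+1}=\dots=y_{\mathcal{D}_l}=\lfloor\mathcal{J}_{k,l}/\mathcal{D}_l\rfloor$. For $k=l$: let $c=2\mathcal{J}_{k,k}\bmod\mathcal{D}_k$ and construct a simple graph $B$ on $\mathcal{D}_k$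 vertices with degrees $x_1=\dots=x_c=\lfloor 2\mathcal{J}_{k,k}/\mathcal{D}_k\rfloor+1$, $x_{c+1}=\dots=x_{\mathcal{D}_k}=\lfloor 2\mathcal{J}_{k,k}/\mathcal{D}_k\rfloor$. Then $B$ is placed into $G$ by identifying the vertices of $B$ on the degree-$k$ side (resp. degree-$l$ side) bijectively with the target-degree-$k$ (resp. $l$) vertices of $G$, where the vertices of $B$ with the larger degrees are matched to vertices of $G$ with higher residual degree, the rest arbitrarily; the edges of $B$ are added to $G$ and residual degrees are updated. -}

module Defs where

open import Data.Nat using (ℕ; zero; suc; _+_; _*_; _<_; _≡ᵇ_; NonZero)
open import Data.Nat.DivMod using (_/_; _%_)
open import Data.Nat.Properties using (_<?_)
open import Data.Fin using (Fin; toℕ; _≟_) renaming (_<_ to _<ᶠ_)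
open import Data.Integer as ℤ using (ℤ; +_; _-_; ∣_∣)
open import Data.Bool using (Bool; if_then_else_; _∧_)
open import Data.Nat.ListAction using (sum)
open import Data.List using (List; []; _∷_; map; length; filter; downFrom; concatMap; _++_; take)
open import Data.List.Relation.Unary.All using (All)
open import Data.List.Relation.Unary.Unique.Propositional using (Unique)
open import Data.Product using (Σ; _×_; _,_; proj₁; proj₂)
open import Relation.Binary.PropositionalEquality using (_≡_; _≢_)
open import Relation.Nullary using (⌊_⌋)
open import Function.Bundles using (_↔_; Inverse)

bal : (n m : ℕ) → Fin n → ℕ
bal zero m ()
bal (suc n) m i = if ⌊ toℕ i <? (m % suc n) ⌋ then suc (m / suc n) else m / suc n

sumTo : ℕ → (ℕ → ℕ) → ℕ
sumTo zero f = 0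
sumTo (suc K) f = sumTo K f + f (suc K)

-- Processing order: (k,l), k ≥ l ≥ 1, decreasing k, then decreasing l.
schedule : ℕ → List (ℕ × ℕ)
schedule K = concatMap (λ k → map (λ l → (k , l)) (map suc (downFrom k))) (map suc (downFrom K))

-- The algorithm for degrees 1..K and joint degree matrix J.
module Alg (K : ℕ) (J : ℕ → ℕ → ℕ) where

  D : ℕ → ℕ
  D zero = 0
  D (suc m) = (J (suc m) (suc m) + sumTo K (J (suc m))) / suc m

  -- an edge of G between vertex i of class k and vertex j of class l
  record Edge : Set where
    constructor mkE
    field
      k : ℕ
      l : ℕ
      i : Fin (D k)
      j : Fin (D l)

  Graph : Set
  Graph = List Edge

  hit : (k' : ℕ) → Fin (D k') → (k : ℕ) → Fin (D k) → ℕ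
  hit k' i' k v = if (k' ≡ᵇ k) ∧ (toℕ i' ≡ᵇ toℕ v) then 1 else 0

  deg : Graph → (k : ℕ) → Fin (D k) → ℕ
  deg G k v = sum (map (λ e → hit (Edge.k e) (Edge.i e) k v + hit (Edge.l e) (Edge.j e) k v) G)

  res : Graph → (k : ℕ) → Fin (D k) → ℤ
  res G k v = + k - + deg G k v

  degL : ∀ {m n} → List (Fin m × Fin n) → Fin m → ℕ
  degL B i = length (filter (λ e → proj₁ e ≟ i) B)

  degR : ∀ {m n} → List (Fin m × Fin n) → Fin n → ℕ
  degR B j = length (filter (λ e → proj₂ e ≟ j) B)

  -- placement rule: B-vertices of larger degree go to G-vertices of higher residual degree
  Matched : Graph → (k : ℕ) → (Fin (D k) → ℕ) → (Fin (D k) ↔ Fin (D k)) → Set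
  Matched G k x σ = ∀ i i' → x i' < x i →
    res G k (Inverse.to σ i') ℤ.≤ res G k (Inverse.to σ i)

  data Step : ℕ × ℕ → Graph → Graph → Set where
    stepNe : ∀ {k l G} → k ≢ l →
      (B : List (Fin (D k) × Fin (D l))) → Unique B →
      (∀ i → degL B i ≡ bal (D k) (J k l) i) →
      (∀ j → degR B j ≡ bal (D l) (J k l) j) →
      (σ : Fin (D k) ↔ Fin (D k)) → (τ : Fin (D l) ↔ Fin (D l)) →
      Matched G k (bal (D k) (J k l)) σ →
      Matched G l (bal (D l) (J k l)) τ →
      Step (k , l) G (map (λ e → mkE k l (Inverse.to σ (proj₁ e)) (Inverse.to τ (proj₂ e))) B ++ G)
    stepEq : ∀ {k G} →
      (B : List (Fin (D k) × Fin (D k))) → Unique B →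
      All (λ e → proj₁ e <ᶠ proj₂ e) B →
      (∀ i → degL B i + degR B i ≡ bal (D k) (2 * J k k) i) →
      (σ : Fin (D k) ↔ Fin (D k)) →
      Matched G k (bal (D k) (2 * J k k)) σ →
      Step (k , k) G (map (λ e → mkE k k (Inverse.to σ (proj₁ e)) (Inverse.to σ (proj₂ e))) B ++ G)

  data Exec : List (ℕ × ℕ) → Graph → Graph → Set where
    done : ∀ {G} → Exec [] G G
    next : ∀ {p ps G G' G''} → Step p G G' → Exec ps G' G'' → Exec (p ∷ ps) G G''

module Submission where

open import Defs
open import Data.Nat using (ℕ; zero; suc; _≤_; _<_; _+_)
open import Data.Nat.Divisibility using (_∣_)
open import Data.Integer as ℤ using ()
open import Data.List using (take; [])
open import Data.Fin using (Fin)
open import Data.Sum using (_⊎_)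
open import Relation.Binary.PropositionalEquality using (_≡_)

open import Data.Nat as ℕ using (_∸_; z≤n; s≤s)
import Data.Nat.Properties as ℕP
open import Data.Nat.ListAction using (sum)
open import Data.Nat.ListAction.Properties using (sum-++)
open import Data.Nat.Solver using (module +-*-Solver)
open import Data.Integer using (_⊖_)
import Data.Integer.Properties as ℤP
open import Data.Integer.Solver as ℤSolver using ()
open import Data.List using (List; _∷_; map; filter; length; _++_)
open import Data.List.Properties using (map-∘; map-++)
import Data.Fin as Fin
import Data.Fin.Properties as FinP
open import Data.Bool using (true; false; if_then_else_)
open import Data.Product using (_×_; _,_; proj₁; proj₂)
open import Data.Empty using (⊥-elim)
open import Relation.Nullary using (yes; no; does; ⌊_⌋)
open import Relation.Nullary.Decidable using (dec-true; dec-false)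
open import Relation.Unary using (Pred; Decidable)
open import Relation.Binary.PropositionalEquality
  using (refl; sym; trans; cong; cong₂; subst; subst₂; _≢_)
open import Function using (_∘_)
open import Function.Bundles using (_↔_; Inverse)

-- Call d : Fin n → ℕ balanced if any two of its values differ
-- by at most one.  The empty graph has all degrees 0, so every degree class is
-- balanced.  One iteration for the pair (k,l) adds, at the vertices of a class
-- c, an increment which is zero if c ∉ {k,l}, and otherwise is a balanced
-- sequence bal(…) transported along the placement bijection σ; by the
-- placement rule, larger entries land on vertices of larger residual degree,
-- i.e. of smaller current degree.  The arithmetic core (balanced-+) says that
-- adding to a balanced d a balanced increment y that is opposed to d
-- (y u > y v forces d u ≤ d v) gives a balanced sequence.  So by induction
-- every degree class stays balanced, and since residual degrees are k minus
-- degrees they too differ by at most one.  Symmetry of J and integrality of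
-- the class sizes are only needed for the graphs B to exist; balance does not
-- depend on them.

Balanced : ∀ {n} → (Fin n → ℕ) → Set
Balanced d = ∀ u v → d u ≤ suc (d v)

Opposed : ∀ {n} → (Fin n → ℕ) → (Fin n → ℕ) → Set
Opposed y d = ∀ u v → y v < y u → d u ≤ d v

balanced-+ : ∀ {n} {y d : Fin n → ℕ} → Balanced y → Balanced d → Opposed y d →
  Balanced (λ w → y w + d w)
balanced-+ {y = y} {d} bal-y bal-d opp u v with y u ℕP.≤? y v
... | yes yu≤yv =
  subst (y u + d u ≤_) (ℕP.+-suc (y v) (d v)) (ℕP.+-mono-≤ yu≤yv (bal-d u v))
... | no yu≰yv = ℕP.+-mono-≤ (bal-y u v) (opp u v (ℕP.≰⇒> yu≰yv))

bal-bounds : ∀ n m (i : Fin (suc n)) →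
  m ℕ./ suc n ≤ bal (suc n) m i × bal (suc n) m i ≤ suc (m ℕ./ suc n)
bal-bounds n m i = between ⌊ Fin.toℕ i ℕP.<? m ℕ.% suc n ⌋ (m ℕ./ suc n)
  where
  between : ∀ b q → q ≤ (if b then suc q else q) × (if b then suc q else q) ≤ suc q
  between true  q = ℕP.n≤1+n q , ℕP.≤-refl
  between false q = ℕP.≤-refl , ℕP.n≤1+n q

bal-balanced : ∀ n m → Balanced (bal n m)
bal-balanced (suc n) m u v =
  ℕP.≤-trans (proj₂ (bal-bounds n m u)) (s≤s (proj₁ (bal-bounds n m v)))

∸≤1 : ∀ x y → x ≤ suc y → x ∸ y ≤ 1
∸≤1 x y x≤1+y = ℕP.m≤n+o⇒m∸n≤o x y (subst (x ≤_) (ℕP.+-comm 1 y) x≤1+y)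

∣⊖∣≤1 : ∀ a b → a ≤ suc b → b ≤ suc a → ℤ.∣ a ⊖ b ∣ ≤ 1
∣⊖∣≤1 a b a≤1+b b≤1+a with a ℕP.≤? b
... | yes a≤b = subst (_≤ 1) (sym (ℤP.∣⊖∣-≤ a≤b)) (∸≤1 b a b≤1+a)
... | no a≰b = subst (_≤ 1) (sym (trans (ℤP.∣m⊖n∣≡∣n⊖m∣ a b) (ℤP.∣⊖∣-≤ b≤a))) (∸≤1 a b a≤1+b)
  where
  b≤a : b ≤ a
  b≤a = ℕP.<⇒≤ (ℕP.≰⇒> a≰b)

≡ᵇ-true : ∀ m n → m ≡ n → (m ℕ.≡ᵇ n) ≡ true
≡ᵇ-true m n = dec-true (m ℕ.≟ n)

≡ᵇ-false : ∀ m n → m ≢ n → (m ℕ.≡ᵇ n) ≡ false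
≡ᵇ-false m n = dec-false (m ℕ.≟ n)

sum-map-+ : ∀ {A : Set} (f g : A → ℕ) xs →
  sum (map (λ x → f x + g x) xs) ≡ sum (map f xs) + sum (map g xs)
sum-map-+ f g [] = refl
sum-map-+ f g (x ∷ xs) = trans (cong (f x + g x +_) (sum-map-+ f g xs))
  (solve 4 (λ a b c d → (a :+ b) :+ (c :+ d) := (a :+ c) :+ (b :+ d)) refl
         (f x) (g x) (sum (map f xs)) (sum (map g xs)))
  where open +-*-Solver

sum-indicator : ∀ {A : Set} {p} {P : Pred A p} (P? : Decidable P) (f : A → ℕ) →
  (∀ x → f x ≡ (if does (P? x) then 1 else 0)) →
  ∀ xs → sum (map f xs) ≡ length (filter P? xs)
sum-indicator P? f f≡ind [] = refl
sum-indicator P? f f≡ind (x ∷ xs) rewrite f≡ind x with does (P? x)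
... | true  = cong suc (sum-indicator P? f f≡ind xs)
... | false = sum-indicator P? f f≡ind xs

sum-zero : ∀ {A : Set} (f : A → ℕ) → (∀ x → f x ≡ 0) → ∀ xs → sum (map f xs) ≡ 0
sum-zero f f≡0 [] = refl
sum-zero f f≡0 (x ∷ xs) = cong₂ _+_ (f≡0 x) (sum-zero f f≡0 xs)

module _ (K : ℕ) (J : ℕ → ℕ → ℕ) where
  open Alg K J

  AllBalanced : Graph → Set
  AllBalanced G = ∀ c → Balanced (deg G c)

  Admissible : Graph → (c : ℕ) → (Fin (D c) → ℕ) → Set
  Admissible G c y = Balanced y × Opposed y (deg G c)

  deg-++ : ∀ A G c w → deg (A ++ G) c w ≡ deg A c w + deg G c w
  deg-++ A G c w = trans (cong sum (map-++ _ A G)) (sum-++ (map _ A) _)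

  extend-balanced : ∀ A G c → Balanced (deg G c) → Admissible G c (deg A c) →
    Balanced (deg (A ++ G) c)
  extend-balanced A G c bal-G (bal-A , opp) u v
    rewrite deg-++ A G c u | deg-++ A G c v = balanced-+ bal-A bal-G opp u v

  res-diff : ∀ G k (a b : Fin (D k)) →
    res G k a ℤ.- res G k b ≡ ℤ.+ deg G k b ℤ.- ℤ.+ deg G k a
  res-diff G k a b = solve 3 (λ t x y → (t :- x) :- (t :- y) := y :- x) refl
                       (ℤ.+ k) (ℤ.+ deg G k a) (ℤ.+ deg G k b)
    where open ℤSolver.+-*-Solver

  res-≤⇒deg-≥ : ∀ G k (a b : Fin (D k)) → res G k a ℤ.≤ res G k b → deg G k b ≤ deg G k a
  res-≤⇒deg-≥ G k a b res≤ = ℤP.drop‿+≤+ (ℤP.i-j≤0⇒i≤j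
    (subst (ℤ._≤ ℤ.0ℤ) (res-diff G k a b) (ℤP.i≤j⇒i-j≤0 res≤)))

  matched⇒opposed : ∀ G k x (σ : Fin (D k) ↔ Fin (D k)) → Matched G k x σ →
    Opposed (x ∘ Inverse.from σ) (deg G k)
  matched⇒opposed G k x σ matched u v x<x
    with res-≤⇒deg-≥ G k _ _ (matched (Inverse.from σ u) (Inverse.from σ v) x<x)
  ... | deg≤ rewrite Inverse.strictlyInverseˡ σ u | Inverse.strictlyInverseˡ σ v = deg≤

  deg-map : ∀ {X : Set} (place : X → Edge) B c w → deg (map place B) c w ≡
    sum (map (λ e → hit (Edge.k (place e)) (Edge.i (place e)) c w) B) +
    sum (map (λ e → hit (Edge.l (place e)) (Edge.j (place e)) c w) B)
  deg-map place B c w = trans (cong sum (sym (map-∘ B))) (sum-map-+ _ _ B)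

  hit-other : ∀ k c (a : Fin (D k)) (w : Fin (D c)) → k ≢ c → hit k a c w ≡ 0
  hit-other k c a w k≢c rewrite ≡ᵇ-false k c k≢c = refl

  hit-placed : ∀ k (σ : Fin (D k) ↔ Fin (D k)) a w →
    hit k (Inverse.to σ a) k w ≡ (if does (a Fin.≟ Inverse.from σ w) then 1 else 0)
  hit-placed k σ a w rewrite ≡ᵇ-true k k refl with a Fin.≟ Inverse.from σ w
  ... | yes a≡σ⁻¹w
    rewrite ≡ᵇ-true _ _ (cong Fin.toℕ (Inverse.inverseˡ σ a≡σ⁻¹w)) = refl
  ... | no  a≢σ⁻¹w
    rewrite ≡ᵇ-false _ _ (λ eq → a≢σ⁻¹w (sym (Inverse.inverseʳ σ (sym (FinP.toℕ-injective eq)))))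
    = refl

  endpoints-placed : ∀ {X : Set} k (σ : Fin (D k) ↔ Fin (D k)) (p : X → Fin (D k)) B w →
    sum (map (λ e → hit k (Inverse.to σ (p e)) k w) B) ≡
    length (filter (λ e → p e Fin.≟ Inverse.from σ w) B)
  endpoints-placed k σ p B w =
    sum-indicator (λ e → p e Fin.≟ Inverse.from σ w) _ (λ e → hit-placed k σ (p e) w) B

  endpoints-other : ∀ {X : Set} k c (q : X → Fin (D k)) B (w : Fin (D c)) → k ≢ c →
    sum (map (λ e → hit k (q e) c w) B) ≡ 0
  endpoints-other k c q B w k≢c = sum-zero _ (λ e → hit-other k c (q e) w k≢c) B

  zero-admissible : ∀ G c (y : Fin (D c) → ℕ) → (∀ w → y w ≡ 0) → Admissible G c y
  zero-admissible G c y y≡0 =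
    (λ u v → subst (_≤ suc (y v)) (sym (y≡0 u)) z≤n) ,
    (λ u v yv<yu → ⊥-elim (ℕP.n≮0 (subst (y v <_) (y≡0 u) yv<yu)))

  placed-admissible : ∀ G k x (σ : Fin (D k) ↔ Fin (D k)) (y : Fin (D k) → ℕ) →
    Balanced x → Matched G k x σ → (∀ w → y w ≡ x (Inverse.from σ w)) → Admissible G k y
  placed-admissible G k x σ y bal-x matched y≡ =
    (λ u v → subst₂ _≤_ (sym (y≡ u)) (cong suc (sym (y≡ v))) (bal-x _ _)) ,
    (λ u v yv<yu → matched⇒opposed G k x σ matched u v (subst₂ _<_ (y≡ v) (y≡ u) yv<yu))

  placeNe : ∀ k l → Fin (D k) ↔ Fin (D k) → Fin (D l) ↔ Fin (D l) →
    Fin (D k) × Fin (D l) → Edge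
  placeNe k l σ τ e = mkE k l (Inverse.to σ (proj₁ e)) (Inverse.to τ (proj₂ e))

  placeEq : ∀ k → Fin (D k) ↔ Fin (D k) → Fin (D k) × Fin (D k) → Edge
  placeEq k σ e = mkE k k (Inverse.to σ (proj₁ e)) (Inverse.to σ (proj₂ e))

  stepNe-admissible : ∀ {k l G} → k ≢ l → (B : List (Fin (D k) × Fin (D l))) →
    (∀ i → degL B i ≡ bal (D k) (J k l) i) → (∀ j → degR B j ≡ bal (D l) (J k l) j) →
    (σ : Fin (D k) ↔ Fin (D k)) (τ : Fin (D l) ↔ Fin (D l)) →
    Matched G k (bal (D k) (J k l)) σ → Matched G l (bal (D l) (J k l)) τ →
    ∀ c → Admissible G c (deg (map (placeNe k l σ τ) B) c)
  stepNe-admissible {k} {l} {G} k≢l B degL≡ degR≡ σ τ mσ mτ c with c ℕ.≟ k | c ℕ.≟ l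
  ... | yes refl | _ = placed-admissible G c _ σ _ (bal-balanced _ _) mσ λ w →
    trans (deg-map (placeNe k l σ τ) B c w)
          (trans (cong₂ _+_ (endpoints-placed c σ proj₁ B w)
                            (endpoints-other l c (Inverse.to τ ∘ proj₂) B w (k≢l ∘ sym)))
                 (trans (ℕP.+-identityʳ _) (degL≡ (Inverse.from σ w))))
  ... | no _ | yes refl = placed-admissible G c _ τ _ (bal-balanced _ _) mτ λ w →
    trans (deg-map (placeNe k l σ τ) B c w)
          (trans (cong₂ _+_ (endpoints-other k c (Inverse.to σ ∘ proj₁) B w k≢l)
                            (endpoints-placed c τ proj₂ B w))
                 (degR≡ (Inverse.from τ w)))
  ... | no c≢k | no c≢l = zero-admissible G c _ λ w →
    trans (deg-map (placeNe k l σ τ) B c w)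
          (cong₂ _+_ (endpoints-other k c (Inverse.to σ ∘ proj₁) B w (c≢k ∘ sym))
                     (endpoints-other l c (Inverse.to τ ∘ proj₂) B w (c≢l ∘ sym)))

  stepEq-admissible : ∀ {k G} (B : List (Fin (D k) × Fin (D k))) →
    (∀ i → degL B i + degR B i ≡ bal (D k) (2 ℕ.* J k k) i) →
    (σ : Fin (D k) ↔ Fin (D k)) → Matched G k (bal (D k) (2 ℕ.* J k k)) σ →
    ∀ c → Admissible G c (deg (map (placeEq k σ) B) c)
  stepEq-admissible {k} {G} B deg≡ σ mσ c with c ℕ.≟ k
  ... | yes refl = placed-admissible G c _ σ _ (bal-balanced _ _) mσ λ w →
    trans (deg-map (placeEq k σ) B c w)
          (trans (cong₂ _+_ (endpoints-placed c σ proj₁ B w) (endpoints-placed c σ proj₂ B w))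
                 (deg≡ (Inverse.from σ w)))
  ... | no c≢k = zero-admissible G c _ λ w →
    trans (deg-map (placeEq k σ) B c w)
          (cong₂ _+_ (endpoints-other k c (Inverse.to σ ∘ proj₁) B w (c≢k ∘ sym))
                     (endpoints-other k c (Inverse.to σ ∘ proj₂) B w (c≢k ∘ sym)))

  step-balanced : ∀ {p G G'} → Step p G G' → AllBalanced G → AllBalanced G'
  step-balanced {G = G} (stepNe {k} {l} k≢l B _ degL≡ degR≡ σ τ mσ mτ) bal-G c =
    extend-balanced (map (placeNe k l σ τ) B) G c (bal-G c)
      (stepNe-admissible {k} {l} {G} k≢l B degL≡ degR≡ σ τ mσ mτ c)
  step-balanced {G = G} (stepEq {k} B _ _ deg≡ σ mσ) bal-G c =
    extend-balanced (map (placeEq k σ) B) G c (bal-G c) (stepEq-admissible {k} {G} B deg≡ σ mσ c)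

  exec-balanced : ∀ {ps G G'} → Exec ps G G' → AllBalanced G → AllBalanced G'
  exec-balanced done bal-G = bal-G
  exec-balanced (next step run) bal-G = exec-balanced run (step-balanced step bal-G)

mainTheorem3 : (K : ℕ) (J : ℕ → ℕ → ℕ) →
    (∀ k l → J k l ≡ J l k) →
    (∀ k l → (k ≡ 0 ⊎ K < k) → J k l ≡ 0) →
    (∀ k → 1 ≤ k → k ≤ K → k ∣ J k k + sumTo K (J k)) →
    ∀ n G → Alg.Exec K J (take n (schedule K)) [] G →
    ∀ k (u v : Fin (Alg.D K J k)) → ℤ.∣ Alg.res K J G k u ℤ.- Alg.res K J G k v ∣ ≤ 1
mainTheorem3 K J _ _ _ n G run k u v = begin
  ℤ.∣ res G k u ℤ.- res G k v ∣               ≡⟨ cong ℤ.∣_∣ (res-diff K J G k u v) ⟩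
  ℤ.∣ ℤ.+ deg G k v ℤ.- ℤ.+ deg G k u ∣       ≡⟨ cong ℤ.∣_∣ (ℤP.[+m]-[+n]≡m⊖n (deg G k v) (deg G k u)) ⟩
  ℤ.∣ deg G k v ⊖ deg G k u ∣                 ≤⟨ ∣⊖∣≤1 (deg G k v) (deg G k u) (balanced k v u) (balanced k u v) ⟩
  1                                           ∎
  where
  open Alg K J
  open ℕP.≤-Reasoning
  balanced : AllBalanced K J G
  balanced = exec-balanced K J run (λ _ _ _ → z≤n)
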